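{- Let $\alpha\ge -1$ be an integer. For every positive integer $n$, \[ L^{(\alpha)}_n(x;y|q)=\sum_{k=0}^n{n\brack k}_q\prod_{j=1}^k[\alpha+j]_q\,y^{k}\,L^{(-1)}_{n-k}(x;y|q). \]
   Context: Notation: $[n]_q=\frac{1-q^n}{1-q}$, $n!_q=\prod_{i=1}^n[i]_q$, ${n\brack k}_q=\frac{n!_q}{k!_q(n-k)!_q}$. For an integer $\alpha\ge -1$, $L^{(\alpha)}_n(x;y;q)$ is defined by $L^{(\alpha)}_{ -1}=0$, $L^{(\alpha)}_0=1$ and, for $n\ge 0$, $L^{(\alpha)}_{n+1}(x;y;q)=\bigl(x-(y[n+\alpha+1]_q+[n]_q)\bigr)L^{(\alpha)}_n(x;y;q)-y[n]_q[n+\alpha]_q\,L^{(\alpha)}_{n-1}(x;y;q)$, and $L^{(\alpha)}_n(x;y|q):=(-1)^nL^{(\alpha)}_n(-x;y;q)$. -}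

module Defs where

open import Data.Nat as ℕ using (ℕ; zero; suc)
open import Algebra.Bundles using (CommutativeRing)

-- q-Laguerre polynomials evaluated in an arbitrary commutative ring
-- (a polynomial identity in ℤ[x,y,q] holds iff it holds under every
-- evaluation in every commutative ring).
-- The integer α ≥ -1 is encoded as a = α + 1 : ℕ.
module QLaguerre {c ℓ} (R : CommutativeRing c ℓ) where
  open CommutativeRing R

  pow : Carrier → ℕ → Carrier
  pow x zero    = 1#
  pow x (suc n) = x * pow x n

  qint : Carrier → ℕ → Carrier
  qint q zero    = 0#
  qint q (suc n) = 1# + q * qint q n

  qbinom : Carrier → ℕ → ℕ → Carrier
  qbinom q zero    zero    = 1#
  qbinom q zero    (suc k) = 0#
  qbinom q (suc n) zero    = 1#
  qbinom q (suc n) (suc k) = qbinom q n k + pow q (suc k) * qbinom q n (suc k)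

  -- ∏_{j=1}^k [α+j]_q = ∏_{i=0}^{k-1} [a+i]_q  with a = α+1
  rise : Carrier → ℕ → ℕ → Carrier
  rise q a zero    = 1#
  rise q a (suc k) = rise q a k * qint q (a ℕ.+ k)

  sumTo : ℕ → (ℕ → Carrier) → Carrier
  sumTo zero    f = f 0
  sumTo (suc n) f = sumTo n f + f (suc n)

  L : ℕ → Carrier → Carrier → Carrier → ℕ → Carrier
  L a x y q zero          = 1#
  L a x y q (suc zero)    = x - (y * qint q a + qint q 0)
  L a x y q (suc (suc m)) =
    (x - (y * qint q (suc m ℕ.+ a) + qint q (suc m))) * L a x y q (suc m)
    - y * qint q (suc m) * qint q (m ℕ.+ a) * L a x y q m

  -- L^(α)_n(x;y|q) = (-1)^n L^(α)_n(-x;y;q)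
  Lbar : ℕ → Carrier → Carrier → Carrier → ℕ → Carrier
  Lbar a x y q n = pow (- 1#) n * L a (- x) y q n

module Submission where

-- Both sides satisfy the same recursion in a = α + 1 and agree at a = 0;
-- the file establishes the two recursions and then inducts on a and n.
--   * Contiguous relation.  From the three-term recurrence one shows
--       L^(a)_{n+1} = L^(a+1)_{n+1} + y q^a [n+1] L^(a+1)_n,
--     by a two-step induction on n whose step is a single polynomial
--     identity ('contiguous-step'), after writing every coefficient
--     [m + a] as [a] + q^a [m].  In the (x;y|q) normalisation this reads
--     Lbar^(a+1)_{n+1} = Lbar^(a)_{n+1} + y q^a [n+1] Lbar^(a+1)_n.
--   * The right-hand side E(a,n) satisfies the same relation in a, by the
--     absorption identity [k+1][n+1 choose k+1] = [n+1][n choose k] and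
--     the splitting of the rising product ⟨a+1⟩_{k+1} = ⟨a⟩_{k+1} + q^a [k+1] ⟨a+1⟩_k.
--   * For a = 0 the rising product vanishes for k ≥ 1, so E(0,n) = Lbar^(0)_n;
--     for n = 0 both sides are 1.  Induction on a and n finishes the proof.

open import Data.Nat as ℕ using (ℕ; zero; suc; _≤_; _∸_)
import Data.Nat.Properties as ℕP
open import Data.Integer as ℤ using (ℤ; +_; -[1+_])
import Data.Integer.Properties as ℤP
open import Data.Sign as Sign using (Sign)
open import Data.Maybe using (Maybe; just; nothing)
open import Relation.Nullary using (yes; no)
import Relation.Binary.PropositionalEquality as ≡
open import Algebra.Bundles using (CommutativeRing)
open import Algebra.Solver.Ring.AlmostCommutativeRing using (fromCommutativeRing; _-Raw-AlmostCommutative⟶_)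
import Algebra.Solver.Ring as RingSolver
import Relation.Binary.Reasoning.Setoid as SetoidReasoning
open import Defs

-- The ring solver of the standard library normalises polynomial
-- expressions whose coefficients live in a ring with decidable equality
-- mapping homomorphically into the target ring.  For an arbitrary
-- commutative ring R the natural choice is ℤ with its canonical map.
module IntegerCoefficients {ℓ₁ ℓ₂} (R : CommutativeRing ℓ₁ ℓ₂) where
  open CommutativeRing R
  open import Algebra.Properties.Ring ring
    using (-‿involutive; -‿distribˡ-*; -‿+-comm; -0#≈0#; xyx⁻¹≈y)
  open import Algebra.Properties.Semiring.Mult.TCOptimised semiring
    using (_×_; 1+×; ×-homo-+; ×1-homo-*)
  open import Algebra.Properties.CommutativeSemigroup *-commutativeSemigroup
    using (interchange)
  open SetoidReasoning setoid

  ι : ℕ → Carrier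
  ι n = n × 1#

  ⟦_⟧ : ℤ → Carrier
  ⟦ + n ⟧      = ι n
  ⟦ -[1+ n ] ⟧ = - ι (suc n)

  difference-shift : ∀ d a b → (d + a) - (d + b) ≈ a - b
  difference-shift d a b = begin
    (d + a) - (d + b)     ≈⟨ +-congˡ (-‿+-comm d b) ⟨
    (d + a) + (- d - b)   ≈⟨ +-assoc (d + a) (- d) (- b) ⟨
    ((d + a) - d) - b     ≈⟨ +-congʳ (xyx⁻¹≈y d a) ⟩
    a - b                 ∎

  ⊖-homo : ∀ m n → ⟦ m ℤ.⊖ n ⟧ ≈ ι m - ι n
  ⊖-homo m       zero    = sym (trans (+-congˡ -0#≈0#) (+-identityʳ (ι m)))
  ⊖-homo zero    (suc n) = sym (+-identityˡ _)
  ⊖-homo (suc m) (suc n) = begin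
    ⟦ suc m ℤ.⊖ suc n ⟧      ≡⟨ ≡.cong ⟦_⟧ (ℤP.[1+m]⊖[1+n]≡m⊖n m n) ⟩
    ⟦ m ℤ.⊖ n ⟧              ≈⟨ ⊖-homo m n ⟩
    ι m - ι n                ≈⟨ difference-shift 1# (ι m) (ι n) ⟨
    (1# + ι m) - (1# + ι n)  ≈⟨ +-cong (1+× m 1#) (-‿cong (1+× n 1#)) ⟨
    ι (suc m) - ι (suc n)    ∎

  +-homo : ∀ i j → ⟦ i ℤ.+ j ⟧ ≈ ⟦ i ⟧ + ⟦ j ⟧
  +-homo -[1+ m ] -[1+ n ] = begin
    - ι (suc (suc (m ℕ.+ n)))      ≡⟨ ≡.cong (λ k → - ι (suc k)) (ℕP.+-suc m n) ⟨
    - ι (suc m ℕ.+ suc n)          ≈⟨ -‿cong (×-homo-+ 1# (suc m) (suc n)) ⟩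
    - (ι (suc m) + ι (suc n))      ≈⟨ -‿+-comm (ι (suc m)) (ι (suc n)) ⟨
    - ι (suc m) + - ι (suc n)      ∎
  +-homo -[1+ m ] (+ n)    = trans (⊖-homo n (suc m)) (+-comm _ _)
  +-homo (+ m)    -[1+ n ] = ⊖-homo m (suc n)
  +-homo (+ m)    (+ n)    = ×-homo-+ 1# m n

  -‿homo : ∀ i → ⟦ ℤ.- i ⟧ ≈ - ⟦ i ⟧
  -‿homo -[1+ n ]  = sym (-‿involutive _)
  -‿homo (+ zero)  = sym -0#≈0#
  -‿homo (+ suc n) = refl

  σ : Sign → Carrier
  σ Sign.+ = 1#
  σ Sign.- = - 1#

  σ-homo : ∀ s t → σ (s Sign.* t) ≈ σ s * σ t
  σ-homo Sign.+ t      = sym (*-identityˡ _)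
  σ-homo Sign.- Sign.+ = sym (*-identityʳ _)
  σ-homo Sign.- Sign.- = begin
    1#              ≈⟨ -‿involutive 1# ⟨
    - - 1#          ≈⟨ -‿cong (*-identityˡ (- 1#)) ⟨
    - (1# * - 1#)   ≈⟨ -‿distribˡ-* 1# (- 1#) ⟩
    - 1# * - 1#     ∎

  ◃-homo : ∀ s n → ⟦ s ℤ.◃ n ⟧ ≈ σ s * ι n
  ◃-homo s      zero    = sym (zeroʳ _)
  ◃-homo Sign.+ (suc n) = sym (*-identityˡ _)
  ◃-homo Sign.- (suc n) = trans (-‿cong (sym (*-identityˡ _))) (-‿distribˡ-* _ _)

  sign-abs : ∀ i → ⟦ i ⟧ ≈ σ (ℤ.sign i) * ι ℤ.∣ i ∣
  sign-abs i = trans (reflexive (≡.cong ⟦_⟧ (≡.sym (ℤP.◃-inverse i)))) (◃-homo (ℤ.sign i) ℤ.∣ i ∣)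

  *-homo : ∀ i j → ⟦ i ℤ.* j ⟧ ≈ ⟦ i ⟧ * ⟦ j ⟧
  *-homo i j = begin
    ⟦ i ℤ.* j ⟧                                  ≈⟨ ◃-homo (ℤ.sign i Sign.* ℤ.sign j) (ℤ.∣ i ∣ ℕ.* ℤ.∣ j ∣) ⟩
    σ (ℤ.sign i Sign.* ℤ.sign j) * ι (ℤ.∣ i ∣ ℕ.* ℤ.∣ j ∣)
      ≈⟨ *-cong (σ-homo (ℤ.sign i) (ℤ.sign j)) (×1-homo-* ℤ.∣ i ∣ ℤ.∣ j ∣) ⟩
    (σ (ℤ.sign i) * σ (ℤ.sign j)) * (ι ℤ.∣ i ∣ * ι ℤ.∣ j ∣) ≈⟨ interchange _ _ _ _ ⟩
    (σ (ℤ.sign i) * ι ℤ.∣ i ∣) * (σ (ℤ.sign j) * ι ℤ.∣ j ∣) ≈⟨ *-cong (sign-abs i) (sign-abs j) ⟨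
    ⟦ i ⟧ * ⟦ j ⟧                                ∎

  homomorphism : ℤ.+-*-rawRing -Raw-AlmostCommutative⟶ fromCommutativeRing R
  homomorphism = record
    { ⟦_⟧ = ⟦_⟧ ; +-homo = +-homo ; *-homo = *-homo ; -‿homo = -‿homo
    ; 0-homo = refl ; 1-homo = refl }

  coefficient-equality : ∀ i j → Maybe (⟦ i ⟧ ≈ ⟦ j ⟧)
  coefficient-equality i j with i ℤP.≟ j
  ... | yes ≡.refl = just refl
  ... | no _       = nothing

  open RingSolver ℤ.+-*-rawRing (fromCommutativeRing R) homomorphism coefficient-equality public
    using (solve; _:=_; Polynomial; _:+_; _:*_; _:-_; con)

module Development {ℓ₁ ℓ₂} (R : CommutativeRing ℓ₁ ℓ₂) where
  open CommutativeRing R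
  open QLaguerre R
  open IntegerCoefficients R
  open import Algebra.Properties.CommutativeSemigroup +-commutativeSemigroup
    using () renaming (interchange to +-interchange)
  open SetoidReasoning setoid

  𝟘 𝟙 : ∀ {m} → Polynomial m
  𝟘 = con (+ 0)
  𝟙 = con (+ 1)

  qint-+ : ∀ q m n → qint q (m ℕ.+ n) ≈ qint q m + pow q m * qint q n
  qint-+ q zero    n = sym (trans (+-identityˡ _) (*-identityˡ _))
  qint-+ q (suc m) n = begin
    1# + q * qint q (m ℕ.+ n)                     ≈⟨ +-congˡ (*-congˡ (qint-+ q m n)) ⟩
    1# + q * (qint q m + pow q m * qint q n)      ≈⟨ regroup q (qint q m) (pow q m) (qint q n) ⟩
    (1# + q * qint q m) + q * pow q m * qint q n  ∎
    where
    regroup = solve 4 (λ q a p b → 𝟙 :+ q :* (a :+ p :* b) := (𝟙 :+ q :* a) :+ (q :* p) :* b) refl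

  qint-split : ∀ q a n → qint q (n ℕ.+ a) ≈ qint q a + pow q a * qint q n
  qint-split q a n = trans (reflexive (≡.cong (qint q) (ℕP.+-comm n a))) (qint-+ q a n)

  qint-one : ∀ q → qint q 1 ≈ 1#
  qint-one q = trans (+-congˡ (zeroʳ q)) (+-identityʳ 1#)

  rise-peel : ∀ q a k → rise q a (suc k) ≈ qint q a * rise q (suc a) k
  rise-peel q a zero = begin
    1# * qint q (a ℕ.+ 0)  ≈⟨ *-identityˡ _ ⟩
    qint q (a ℕ.+ 0)       ≡⟨ ≡.cong (qint q) (ℕP.+-identityʳ a) ⟩
    qint q a               ≈⟨ *-identityʳ _ ⟨
    qint q a * 1#          ∎
  rise-peel q a (suc k) = begin
    rise q a (suc k) * qint q (a ℕ.+ suc k)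
      ≈⟨ *-cong (rise-peel q a k) (reflexive (≡.cong (qint q) (ℕP.+-suc a k))) ⟩
    qint q a * rise q (suc a) k * qint q (suc a ℕ.+ k)  ≈⟨ *-assoc _ _ _ ⟩
    qint q a * rise q (suc a) (suc k)                   ∎

  rise-from-zero : ∀ q k → rise q 0 (suc k) ≈ 0#
  rise-from-zero q k = trans (rise-peel q 0 k) (zeroˡ _)

  rise-contiguous : ∀ q a k →
    rise q (suc a) (suc k) ≈ rise q a (suc k) + pow q a * qint q (suc k) * rise q (suc a) k
  rise-contiguous q a k = begin
    r * qint q (suc a ℕ.+ k)                       ≈⟨ *-congˡ last-factor ⟩
    r * (qint q a + pow q a * qint q (suc k))      ≈⟨ distribute r (qint q a) (pow q a) (qint q (suc k)) ⟩
    qint q a * r + pow q a * qint q (suc k) * r    ≈⟨ +-congʳ (rise-peel q a k) ⟨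
    rise q a (suc k) + pow q a * qint q (suc k) * r ∎
    where
    r = rise q (suc a) k
    last-factor : qint q (suc a ℕ.+ k) ≈ qint q a + pow q a * qint q (suc k)
    last-factor = trans (reflexive (≡.cong (qint q) (≡.sym (ℕP.+-suc a k)))) (qint-+ q a (suc k))
    distribute = solve 4 (λ r a p b → r :* (a :+ p :* b) := a :* r :+ p :* b :* r) refl

  qbinom-zero : ∀ q n → qbinom q n 0 ≈ 1#
  qbinom-zero q zero    = refl
  qbinom-zero q (suc n) = refl

  qbinom-one : ∀ q n → qbinom q n 1 ≈ qint q n
  qbinom-one q zero    = refl
  qbinom-one q (suc n) = +-cong (qbinom-zero q n) (*-cong (*-identityʳ q) (qbinom-one q n))

  absorption : ∀ q n k → qint q (suc k) * qbinom q (suc n) (suc k) ≈ qint q (suc n) * qbinom q n k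
  absorption q n zero = begin
    qint q 1 * qbinom q (suc n) 1  ≈⟨ *-cong (qint-one q) (qbinom-one q (suc n)) ⟩
    1# * qint q (suc n)            ≈⟨ *-comm _ _ ⟩
    qint q (suc n) * 1#            ≈⟨ *-congˡ (qbinom-zero q n) ⟨
    qint q (suc n) * qbinom q n 0  ∎
  absorption q zero (suc k) = begin
    qint q (2 ℕ.+ k) * (0# + pow q (2 ℕ.+ k) * 0#)  ≈⟨ *-congˡ (trans (+-identityˡ _) (zeroʳ _)) ⟩
    qint q (2 ℕ.+ k) * 0#                            ≈⟨ zeroʳ _ ⟩
    0#                                               ≈⟨ zeroʳ _ ⟨
    qint q 1 * 0#                                    ∎
  absorption q (suc n) (suc k) = begin
    (1# + q * K) * (b + P * b′)                        ≈⟨ expand q K b P b′ ⟩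
    b + q * (K * b) + P * (qint q (2 ℕ.+ k) * b′)
      ≈⟨ +-cong (+-congˡ (*-congˡ (absorption q n k))) (*-congˡ (absorption q n (suc k))) ⟩
    b + q * (N * qbinom q n k) + P * (N * qbinom q n (suc k))
      ≈⟨ factor q N (qbinom q n k) (pow q (suc k)) (qbinom q n (suc k)) ⟩
    (1# + q * N) * b                                   ∎
    where
    K = qint q (suc k)
    N = qint q (suc n)
    P = pow q (2 ℕ.+ k)
    b = qbinom q (suc n) (suc k)
    b′ = qbinom q (suc n) (2 ℕ.+ k)
    expand = solve 5 (λ q K b P b′ →
      (𝟙 :+ q :* K) :* (b :+ P :* b′) := b :+ q :* (K :* b) :+ P :* ((𝟙 :+ q :* K) :* b′)) refl
    factor = solve 5 (λ q N c p e →
      (c :+ p :* e) :+ q :* (N :* c) :+ (q :* p) :* (N :* e) := (𝟙 :+ q :* N) :* (c :+ p :* e)) refl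

  sumTo-*ˡ : ∀ n d f → d * sumTo n f ≈ sumTo n (λ k → d * f k)
  sumTo-*ˡ zero    d f = refl
  sumTo-*ˡ (suc n) d f = trans (distribˡ d _ _) (+-congʳ (sumTo-*ˡ n d f))

  sumTo-head : ∀ n f → (∀ k → f (suc k) ≈ 0#) → sumTo n f ≈ f 0
  sumTo-head zero    f tail = refl
  sumTo-head (suc n) f tail = trans (+-cong (sumTo-head n f tail) (tail n)) (+-identityʳ _)

  sumTo-merge : ∀ n {f g h} → f 0 ≈ h 0 → (∀ k → f (suc k) + g k ≈ h (suc k)) →
                sumTo (suc n) f + sumTo n g ≈ sumTo (suc n) h
  sumTo-merge zero    {f} {g} head step =
    trans (+-assoc (f 0) (f 1) (g 0)) (+-cong head (step 0))
  sumTo-merge (suc n) {f} {g} head step =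
    trans (+-interchange (sumTo (suc n) f) (f (2 ℕ.+ n)) (sumTo n g) (g (suc n)))
          (+-cong (sumTo-merge n head step) (step (suc n)))

  recurrence : (x y u v w P₁ P₀ : Carrier) → Carrier
  recurrence x y u v w P₁ P₀ = (x - (y * u + v)) * P₁ - y * v * w * P₀

  recurrence-cong : ∀ x y {u u′} v {w w′ P₁ P₁′ P₀ P₀′} →
    u ≈ u′ → w ≈ w′ → P₁ ≈ P₁′ → P₀ ≈ P₀′ →
    recurrence x y u v w P₁ P₀ ≈ recurrence x y u′ v w′ P₁′ P₀′
  recurrence-cong x y v u≈ w≈ P₁≈ P₀≈ =
    +-cong (*-cong (+-congˡ (-‿cong (+-congʳ (*-congˡ u≈)))) P₁≈) (-‿cong (*-cong (*-congˡ w≈) P₀≈))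

  recurrence-first : ∀ x y u w → x - (y * u + 0#) ≈ recurrence x y u 0# w 1# 0#
  recurrence-first = solve 4 (λ x y u w → x :- (y :* u :+ 𝟘) := (x :- (y :* u :+ 𝟘)) :* 𝟙 :- y :* 𝟘 :* w :* 𝟘) refl

  contiguous-step : ∀ x y A Q t₀ t₁ t₂ {B₀ B₁ B₂ L₀ L₁} →
    B₂ ≈ recurrence x y (A + Q * t₁) t₀ (A + Q * t₀) B₁ B₀ →
    L₁ ≈ B₂ + y * Q * t₁ * B₁ →
    L₀ ≈ B₁ + y * Q * t₀ * B₀ →
    recurrence x y (A + Q * t₁) t₁ (A + Q * t₀) L₁ L₀
      ≈ recurrence x y (A + Q * t₂) t₁ (A + Q * t₁) B₂ B₁ + y * Q * t₂ * B₂
  contiguous-step x y A Q t₀ t₁ t₂ {B₀} {B₁} {B₂} {L₀} {L₁} B₂≈ L₁≈ L₀≈ = begin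
    recurrence x y (A + Q * t₁) t₁ (A + Q * t₀) L₁ L₀
      ≈⟨ recurrence-cong x y t₁ refl refl (trans L₁≈ (+-congʳ B₂≈)) L₀≈ ⟩
    recurrence x y (A + Q * t₁) t₁ (A + Q * t₀) (B₂′ + y * Q * t₁ * B₁) (B₁ + y * Q * t₀ * B₀)
      ≈⟨ identity x y A Q t₀ t₁ t₂ B₀ B₁ ⟩
    recurrence x y (A + Q * t₂) t₁ (A + Q * t₁) B₂′ B₁ + y * Q * t₂ * B₂′
      ≈⟨ +-cong (recurrence-cong x y t₁ refl refl B₂≈ refl) (*-congˡ B₂≈) ⟨
    recurrence x y (A + Q * t₂) t₁ (A + Q * t₁) B₂ B₁ + y * Q * t₂ * B₂ ∎
    where
    B₂′ = recurrence x y (A + Q * t₁) t₀ (A + Q * t₀) B₁ B₀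
    identity = solve 9 (λ x y A Q t₀ t₁ t₂ B₀ B₁ →
      let rec = λ u v w P₁ P₀ → (x :- (y :* u :+ v)) :* P₁ :- y :* v :* w :* P₀
          B₂  = rec (A :+ Q :* t₁) t₀ (A :+ Q :* t₀) B₁ B₀
      in  rec (A :+ Q :* t₁) t₁ (A :+ Q :* t₀) (B₂ :+ y :* Q :* t₁ :* B₁) (B₁ :+ y :* Q :* t₀ :* B₀)
          := rec (A :+ Q :* t₂) t₁ (A :+ Q :* t₁) B₂ B₁ :+ y :* Q :* t₂ :* B₂) refl

  module Contiguous (a : ℕ) (x y q : Carrier) where
    A Q : Carrier
    A = qint q a
    Q = pow q a

    coeff : ℕ → Carrier
    coeff n = A + Q * qint q n

    previous : ℕ → Carrier
    previous zero    = 0#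
    previous (suc n) = L (suc a) x y q n

    L-recurrence : ∀ n → L a x y q (2 ℕ.+ n)
      ≈ recurrence x y (coeff (suc n)) (qint q (suc n)) (coeff n) (L a x y q (suc n)) (L a x y q n)
    L-recurrence n = recurrence-cong x y _ (qint-split q a (suc n)) (qint-split q a n) refl refl

    L⁺-recurrence : ∀ n → L (suc a) x y q (suc n)
      ≈ recurrence x y (coeff (suc n)) (qint q n) (coeff n) (L (suc a) x y q n) (previous n)
    L⁺-recurrence zero =
      trans (+-congˡ (-‿cong (+-congʳ (*-congˡ (qint-split q a 1))))) (recurrence-first x y _ _)
    L⁺-recurrence (suc n) = recurrence-cong x y _ (shifted (suc n)) (shifted n) refl refl
      where
      shifted : ∀ m → qint q (m ℕ.+ suc a) ≈ coeff (suc m)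
      shifted m = trans (reflexive (≡.cong (qint q) (ℕP.+-suc m a))) (qint-split q a (suc m))

    contiguous : ∀ n → L a x y q (suc n) ≈ L (suc a) x y q (suc n) + y * Q * qint q (suc n) * L (suc a) x y q n
    contiguous-previous : ∀ n → L a x y q n ≈ L (suc a) x y q n + y * Q * qint q n * previous n

    contiguous zero = begin
      x - (y * A + 0#)                                                     ≈⟨ base x y A Q (qint q 1) ⟩
      recurrence x y (coeff 1) 0# (coeff 0) 1# 0# + y * Q * qint q 1 * 1#  ≈⟨ +-congʳ (L⁺-recurrence 0) ⟨
      L (suc a) x y q 1 + y * Q * qint q 1 * 1#                            ∎
      where
      base = solve 5 (λ x y A Q t → x :- (y :* A :+ 𝟘)
        := ((x :- (y :* (A :+ Q :* t) :+ 𝟘)) :* 𝟙 :- y :* 𝟘 :* (A :+ Q :* 𝟘) :* 𝟘) :+ y :* Q :* t :* 𝟙) refl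
    contiguous (suc n) = begin
      L a x y q (2 ℕ.+ n)
        ≈⟨ L-recurrence n ⟩
      recurrence x y (coeff (suc n)) (qint q (suc n)) (coeff n) (L a x y q (suc n)) (L a x y q n)
        ≈⟨ contiguous-step x y A Q (qint q n) (qint q (suc n)) (qint q (2 ℕ.+ n))
             (L⁺-recurrence n) (contiguous n) (contiguous-previous n) ⟩
      recurrence x y (coeff (2 ℕ.+ n)) (qint q (suc n)) (coeff (suc n)) (L (suc a) x y q (suc n)) (L (suc a) x y q n)
        + y * Q * qint q (2 ℕ.+ n) * L (suc a) x y q (suc n)
        ≈⟨ +-congʳ (L⁺-recurrence (suc n)) ⟨
      L (suc a) x y q (2 ℕ.+ n) + y * Q * qint q (2 ℕ.+ n) * L (suc a) x y q (suc n) ∎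

    contiguous-previous zero    = sym (trans (+-congˡ (zeroʳ _)) (+-identityʳ 1#))
    contiguous-previous (suc n) = contiguous n

  Lbar-contiguous : ∀ a x y q n →
    Lbar (suc a) x y q (suc n) ≈ Lbar a x y q (suc n) + y * pow q a * qint q (suc n) * Lbar (suc a) x y q n
  Lbar-contiguous a x y q n = begin
    (- 1# * s) * P                    ≈⟨ sign-shuffle s P B d ⟩
    (- 1# * s) * (P + d * B) + d * (s * B)
      ≈⟨ +-congʳ (*-congˡ (Contiguous.contiguous a (- x) y q n)) ⟨
    (- 1# * s) * L a (- x) y q (suc n) + d * (s * B) ∎
    where
    s = pow (- 1#) n
    P = L (suc a) (- x) y q (suc n)
    B = L (suc a) (- x) y q n
    d = y * pow q a * qint q (suc n)
    sign-shuffle = solve 4 (λ s P B d →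
      (con -[1+ 0 ] :* s) :* P := (con -[1+ 0 ] :* s) :* (P :+ d :* B) :+ d :* (s :* B)) refl

  module Expansion (x y q : Carrier) where
    term : ℕ → ℕ → ℕ → Carrier
    term a n k = qbinom q n k * rise q a k * pow y k * Lbar 0 x y q (n ∸ k)

    expansion : ℕ → ℕ → Carrier
    expansion a n = sumTo n (term a n)

    term-contiguous : ∀ a n k →
      term a (suc n) (suc k) + y * pow q a * qint q (suc n) * term (suc a) n k ≈ term (suc a) (suc n) (suc k)
    term-contiguous a n k = begin
      C * ra * (y * p) * l + y * Q * N * (c * r * p * l)  ≈⟨ collect C ra y p l Q N c r ⟩
      C * ra * (y * p) * l + y * Q * r * p * l * (N * c)  ≈⟨ +-congˡ (*-congˡ (absorption q n k)) ⟨
      C * ra * (y * p) * l + y * Q * r * p * l * (K * C)  ≈⟨ factor C ra y p l Q r K ⟩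
      C * (ra + Q * K * r) * (y * p) * l                  ≈⟨ *-congʳ (*-congʳ (*-congˡ (rise-contiguous q a k))) ⟨
      C * rise q (suc a) (suc k) * (y * p) * l            ∎
      where
      C  = qbinom q (suc n) (suc k)
      c  = qbinom q n k
      ra = rise q a (suc k)
      r  = rise q (suc a) k
      p  = pow y k
      l  = Lbar 0 x y q (n ∸ k)
      Q  = pow q a
      N  = qint q (suc n)
      K  = qint q (suc k)
      collect = solve 9 (λ C ra y p l Q N c r →
        C :* ra :* (y :* p) :* l :+ y :* Q :* N :* (c :* r :* p :* l)
        := C :* ra :* (y :* p) :* l :+ y :* Q :* r :* p :* l :* (N :* c)) refl
      factor = solve 8 (λ C ra y p l Q r K →
        C :* ra :* (y :* p) :* l :+ y :* Q :* r :* p :* l :* (K :* C)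
        := C :* (ra :+ Q :* K :* r) :* (y :* p) :* l) refl

    expansion-contiguous : ∀ a n →
      expansion (suc a) (suc n) ≈ expansion a (suc n) + y * pow q a * qint q (suc n) * expansion (suc a) n
    expansion-contiguous a n = sym (begin
      expansion a (suc n) + d * expansion (suc a) n               ≈⟨ +-congˡ (sumTo-*ˡ n d (term (suc a) n)) ⟩
      expansion a (suc n) + sumTo n (λ k → d * term (suc a) n k)  ≈⟨ sumTo-merge n refl (term-contiguous a n) ⟩
      expansion (suc a) (suc n)                                   ∎)
      where
      d = y * pow q a * qint q (suc n)

    expansion-base : ∀ n → Lbar 0 x y q n ≈ expansion 0 n
    expansion-base n = sym (trans (sumTo-head n (term 0 n) vanishing) first)
      where
      vanishing : ∀ k → term 0 n (suc k) ≈ 0#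
      vanishing k = trans (*-congʳ (*-congʳ (trans (*-congˡ (rise-from-zero q k)) (zeroʳ _))))
                          (trans (*-congʳ (zeroˡ _)) (zeroˡ _))
      first : term 0 n 0 ≈ Lbar 0 x y q n
      first = trans (*-congʳ (*-congʳ (*-congʳ (qbinom-zero q n))))
                    (solve 1 (λ l → 𝟙 :* 𝟙 :* 𝟙 :* l := l) refl (Lbar 0 x y q n))

    expansion-theorem : ∀ a n → Lbar a x y q n ≈ expansion a n
    expansion-theorem zero    n       = expansion-base n
    expansion-theorem (suc a) zero    = expansion-base 0
    expansion-theorem (suc a) (suc n) = begin
      Lbar (suc a) x y q (suc n)                                          ≈⟨ Lbar-contiguous a x y q n ⟩
      Lbar a x y q (suc n) + d * Lbar (suc a) x y q n
        ≈⟨ +-cong (expansion-theorem a (suc n)) (*-congˡ (expansion-theorem (suc a) n)) ⟩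
      expansion a (suc n) + d * expansion (suc a) n                       ≈⟨ expansion-contiguous a n ⟨
      expansion (suc a) (suc n)                                           ∎
      where
      d = y * pow q a * qint q (suc n)

proposition2 : ∀ {c ℓ} (R : CommutativeRing c ℓ) (a n : ℕ) → 1 ≤ n →
    let open CommutativeRing R
        open QLaguerre R
    in ∀ (x y q : Carrier) →
       Lbar a x y q n ≈ sumTo n (λ k → qbinom q n k * rise q a k * pow y k * Lbar 0 x y q (n ∸ k))
proposition2 R a n _ x y q = Development.Expansion.expansion-theorem R x y q a n
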